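{- Let $N,M\ge1$ be integers. Define $(a_0,b_0,c_0,d_0)=(0,0,N,M)$ and, while $c_id_i\ne0$, $(a_{i+1},b_{i+1},c_{i+1},d_{i+1})=(a_i,a_i+b_i+c_i,c_i,d_i-c_i)$ if $c_i\le d_i$ and $=(a_i+b_i+d_i,b_i,c_i-d_i,d_i)$ if $c_i>d_i$; let $n$ be the minimal index with $c_nd_n=0$. Then: (1) for each $0\le i\le n$ there are integers $A_i,B_i,C_i,D_i\ge0$ with $a_i=A_iM$, $b_i=B_iN$, $c_i=C_iN-A_iM$, $d_i=D_iM-B_iN$; (2) the sequences $(A_i),(B_i),(C_i),(D_i)$ are non-decreasing, and $A_n,D_n\le N$, $B_n,C_n\le M$. -}

module Defs where

open import Data.Nat using (ℕ; zero; suc; _+_; _∸_; _≤?_)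
open import Relation.Nullary using (yes; no)

-- The quadruple (a_i, b_i, c_i, d_i).  All entries are naturals: a,b only grow,
-- and subtraction is only performed when it is a true subtraction (c ≤ d, resp. c > d).
record Quad : Set where
  constructor ⟨_,_,_,_⟩
  field
    a b c d : ℕ
open Quad public

step : Quad → Quad
step ⟨ a , b , c , d ⟩ with c ≤? d
... | yes _ = ⟨ a , a + b + c , c , d ∸ c ⟩
... | no  _ = ⟨ a + b + d , b , c ∸ d , d ⟩

-- seq N M i = (a_i, b_i, c_i, d_i), starting from (0, 0, N, M).
-- Only indices i ≤ n (n = first index with c_n d_n = 0) are meaningful; the
-- theorem only looks at those.
seq : ℕ → ℕ → ℕ → Quad
seq N M zero    = ⟨ 0 , 0 , N , M ⟩
seq N M (suc i) = step (seq N M i)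

module Submission where

-- Alongside (a, b, c, d) run coefficients (A, B, C, D), starting at (0, 0, 1, 1)
-- and updated by B += C, D += A in the branch c ≤ d and by A += D, C += B
-- otherwise, so they only grow.  The step preserves a = AM, b = BN, c + AM = CN,
-- d + BN = DM together with N = Dc + Ad and M = Bc + Cd.  As c never vanishes,
-- the recursion stops with d = 0 right after a step with c ≤ d, which leaves
-- A ≤ D and C ≤ B; then N = Dc and M = Bc with c ≥ 1 give D ≤ N and B ≤ M.

open import Defs
open import Data.Nat using (ℕ; zero; suc; _+_; _*_; _≤_; _<_; _∸_; _≤?_; >-nonZero)
open import Data.Nat.Properties
open import Data.Nat.Tactic.RingSolver using (solve)
open import Data.Integer using (+_; _-_; _⊖_)
import Data.Integer.Properties as ℤ
open import Data.List using (_∷_; [])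
open import Function using (_∘_)
open import Data.Product using (Σ; _×_; _,_)
open import Relation.Nullary using (yes; no; contradiction)
open import Relation.Binary.PropositionalEquality

private variable
  N M : ℕ
  q k : Quad

coeffStep : Quad → Quad → Quad
coeffStep ⟨ _ , _ , c , d ⟩ ⟨ A , B , C , D ⟩ with c ≤? d
... | yes _ = ⟨ A , B + C , C , D + A ⟩
... | no  _ = ⟨ A + D , B , C + B , D ⟩

coeffs : ℕ → ℕ → ℕ → Quad
coeffs N M zero    = ⟨ 0 , 0 , 1 , 1 ⟩
coeffs N M (suc i) = coeffStep (seq N M i) (coeffs N M i)

-- The last two fields are not part of the theorem; they are what bounds the
-- coefficients once d has vanished.
record Represents (N M : ℕ) (q k : Quad) : Set where
  field
    a≡AM    : a q ≡ a k * M
    b≡BN    : b q ≡ b k * N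
    c+AM≡CN : c q + a k * M ≡ c k * N
    d+BN≡DM : d q + b k * N ≡ d k * M
    N≡Dc+Ad : N ≡ d k * c q + a k * d q
    M≡Bc+Cd : M ≡ b k * c q + c k * d q

represents-≤-step : ∀ {a b c e A B C D} →
                    Represents N M ⟨ a , b , c , c + e ⟩ ⟨ A , B , C , D ⟩ →
                    Represents N M ⟨ a , a + b + c , c , e ⟩ ⟨ A , B + C , C , D + A ⟩
represents-≤-step {N} {M} {c = c} {e} {A} {B} {C} {D}
  record { a≡AM = refl ; b≡BN = refl ; c+AM≡CN = c+AM≡CN ; d+BN≡DM = d+BN≡DM
         ; N≡Dc+Ad = N≡Dc+Ad ; M≡Bc+Cd = M≡Bc+Cd } = record
  { a≡AM    = refl
  ; b≡BN    = begin
      A * M + B * N + c     ≡⟨ solve (A ∷ M ∷ B ∷ N ∷ c ∷ []) ⟩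
      B * N + (c + A * M)   ≡⟨ cong (λ x → B * N + x) c+AM≡CN ⟩
      B * N + C * N         ≡⟨ *-distribʳ-+ N B C ⟨
      (B + C) * N           ∎
  ; c+AM≡CN = c+AM≡CN
  ; d+BN≡DM = begin
      e + (B + C) * N           ≡⟨ cong (λ x → e + x) (*-distribʳ-+ N B C) ⟩
      e + (B * N + C * N)       ≡⟨ cong (λ x → e + (B * N + x)) c+AM≡CN ⟨
      e + (B * N + (c + A * M)) ≡⟨ solve (e ∷ B ∷ N ∷ c ∷ A ∷ M ∷ []) ⟩
      c + e + B * N + A * M     ≡⟨ cong (_+ A * M) d+BN≡DM ⟩
      D * M + A * M             ≡⟨ *-distribʳ-+ M D A ⟨
      (D + A) * M               ∎
  ; N≡Dc+Ad = trans N≡Dc+Ad (solve (D ∷ c ∷ A ∷ e ∷ []))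
  ; M≡Bc+Cd = trans M≡Bc+Cd (solve (B ∷ c ∷ C ∷ e ∷ []))
  }
  where open ≡-Reasoning

represents->-step : ∀ {a b d e A B C D} →
                    Represents N M ⟨ a , b , d + e , d ⟩ ⟨ A , B , C , D ⟩ →
                    Represents N M ⟨ a + b + d , b , e , d ⟩ ⟨ A + D , B , C + B , D ⟩
represents->-step {N} {M} {d = d} {e} {A} {B} {C} {D}
  record { a≡AM = refl ; b≡BN = refl ; c+AM≡CN = c+AM≡CN ; d+BN≡DM = d+BN≡DM
         ; N≡Dc+Ad = N≡Dc+Ad ; M≡Bc+Cd = M≡Bc+Cd } = record
  { a≡AM    = begin
      A * M + B * N + d     ≡⟨ solve (A ∷ M ∷ B ∷ N ∷ d ∷ []) ⟩
      A * M + (d + B * N)   ≡⟨ cong (λ x → A * M + x) d+BN≡DM ⟩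
      A * M + D * M         ≡⟨ *-distribʳ-+ M A D ⟨
      (A + D) * M           ∎
  ; b≡BN    = refl
  ; c+AM≡CN = begin
      e + (A + D) * M           ≡⟨ cong (λ x → e + x) (*-distribʳ-+ M A D) ⟩
      e + (A * M + D * M)       ≡⟨ cong (λ x → e + (A * M + x)) d+BN≡DM ⟨
      e + (A * M + (d + B * N)) ≡⟨ solve (e ∷ A ∷ M ∷ d ∷ B ∷ N ∷ []) ⟩
      d + e + A * M + B * N     ≡⟨ cong (_+ B * N) c+AM≡CN ⟩
      C * N + B * N             ≡⟨ *-distribʳ-+ N C B ⟨
      (C + B) * N               ∎
  ; d+BN≡DM = d+BN≡DM
  ; N≡Dc+Ad = trans N≡Dc+Ad (solve (D ∷ d ∷ e ∷ A ∷ []))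
  ; M≡Bc+Cd = trans M≡Bc+Cd (solve (B ∷ d ∷ e ∷ C ∷ []))
  }
  where open ≡-Reasoning

represents-step : Represents N M q k → Represents N M (step q) (coeffStep q k)
represents-step {q = ⟨ a , b , c , d ⟩} {k = ⟨ A , B , C , D ⟩} r with c ≤? d
... | yes c≤d with e , refl ← m≤n⇒∃[o]m+o≡n c≤d
      rewrite m+n∸m≡n c e = represents-≤-step r
... | no  c≰d with e , refl ← m≤n⇒∃[o]m+o≡n (<⇒≤ (≰⇒> c≰d))
      rewrite m+n∸m≡n d e = represents->-step r

seq-represents : ∀ N M i → Represents N M (seq N M i) (coeffs N M i)
seq-represents N M zero = record
  { a≡AM    = refl
  ; b≡BN    = refl
  ; c+AM≡CN = refl
  ; d+BN≡DM = refl
  ; N≡Dc+Ad = sym (trans (+-identityʳ (1 * N)) (*-identityˡ N))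
  ; M≡Bc+Cd = sym (*-identityˡ M)
  }
seq-represents N M (suc i) = represents-step (seq-represents N M i)

coeffStep-mono : ∀ q k → a k ≤ a (coeffStep q k) × b k ≤ b (coeffStep q k)
                       × c k ≤ c (coeffStep q k) × d k ≤ d (coeffStep q k)
coeffStep-mono ⟨ _ , _ , c , d ⟩ ⟨ A , B , C , D ⟩ with c ≤? d
... | yes _ = ≤-refl , m≤m+n B C , ≤-refl , m≤m+n D A
... | no  _ = m≤m+n A D , ≤-refl , m≤m+n C B , ≤-refl

step-c-positive : 1 ≤ c q → 1 ≤ c (step q)
step-c-positive {⟨ _ , _ , c , d ⟩} 1≤c with c ≤? d
... | yes _   = 1≤c
... | no  c≰d = m<n⇒0<n∸m (≰⇒> c≰d)

seq-c-positive : ∀ {N} M → 1 ≤ N → ∀ i → 1 ≤ c (seq N M i)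
seq-c-positive M 1≤N zero    = 1≤N
seq-c-positive M 1≤N (suc i) = step-c-positive (seq-c-positive M 1≤N i)

step-d≡0⇒c≤d : d q ≢ 0 → d (step q) ≡ 0 → c q ≤ d q
step-d≡0⇒c≤d {⟨ _ , _ , c , d ⟩} d≢0 d′≡0 with c ≤? d
... | yes c≤d = c≤d
... | no  _   = contradiction d′≡0 d≢0

coeffStep-≤ : c q ≤ d q →
              a (coeffStep q k) ≤ d (coeffStep q k) × c (coeffStep q k) ≤ b (coeffStep q k)
coeffStep-≤ {⟨ _ , _ , c , d ⟩} {⟨ A , B , C , D ⟩} c≤d with c ≤? d
... | yes _   = m≤n+m A D , m≤n+m C B
... | no  c≰d = contradiction c≤d c≰d

represents-d≡0-bounds : Represents N M q k → 1 ≤ c q → d q ≡ 0 → d k ≤ N × b k ≤ M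
represents-d≡0-bounds {N} {M} {⟨ _ , _ , c , _ ⟩} {⟨ A , B , C , D ⟩} r 1≤c refl =
    ≤-trans (bound D A) (≤-reflexive (sym N≡Dc+Ad))
  , ≤-trans (bound B C) (≤-reflexive (sym M≡Bc+Cd))
  where
  open Represents r
  bound : ∀ X Y → X ≤ X * c + Y * 0
  bound X Y = ≤-trans (m≤m*n X c {{>-nonZero 1≤c}}) (m≤m+n (X * c) (Y * 0))

c*d≡0⇒d≡0 : 1 ≤ c q → c q * d q ≡ 0 → d q ≡ 0
c*d≡0⇒d≡0 {q} 1≤c cd≡0 =
  m*n≡0⇒m≡0 (d q) (c q) {{>-nonZero 1≤c}} (trans (*-comm (d q) (c q)) cd≡0)

coeffs-bounds : ∀ {N M} → 1 ≤ N → 1 ≤ M → ∀ n →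
                c (seq N M n) * d (seq N M n) ≡ 0 →
                (∀ i → i < n → c (seq N M i) * d (seq N M i) ≢ 0) →
                a (coeffs N M n) ≤ N × d (coeffs N M n) ≤ N
              × b (coeffs N M n) ≤ M × c (coeffs N M n) ≤ M
coeffs-bounds {N} {M} 1≤N 1≤M zero cd≡0 _ =
  contradiction (sym (c*d≡0⇒d≡0 {seq N M 0} 1≤N cd≡0)) (<⇒≢ 1≤M)
coeffs-bounds {N} {M} 1≤N 1≤M (suc m) cd≡0 cd≢0 =
  let A≤D , C≤B = coeffStep-≤ {seq N M m} {coeffs N M m} (step-d≡0⇒c≤d dₘ≢0 dₙ≡0)
      D≤N , B≤M = represents-d≡0-bounds (seq-represents N M (suc m))
                                        (seq-c-positive M 1≤N (suc m)) dₙ≡0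
  in ≤-trans A≤D D≤N , D≤N , B≤M , ≤-trans C≤B B≤M
  where
  dₙ≡0 : d (seq N M (suc m)) ≡ 0
  dₙ≡0 = c*d≡0⇒d≡0 {seq N M (suc m)} (seq-c-positive M 1≤N (suc m)) cd≡0
  dₘ≢0 : d (seq N M m) ≢ 0
  dₘ≢0 dₘ≡0 = cd≢0 m (n<1+n m) (trans (cong (c (seq N M m) *_) dₘ≡0) (*-zeroʳ (c (seq N M m))))

m+n≡o⇒+m≡+o-+n : ∀ {m n o} → m + n ≡ o → + m ≡ + o - + n
m+n≡o⇒+m≡+o-+n {m} {n} refl = sym (begin
  + (m + n) - + n ≡⟨ ℤ.[+m]-[+n]≡m⊖n (m + n) n ⟩
  (m + n) ⊖ n     ≡⟨ ℤ.⊖-≥ (m≤n+m n m) ⟩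
  + (m + n ∸ n)   ≡⟨ cong +_ (m+n∸n≡m m n) ⟩
  + m             ∎)
  where open ≡-Reasoning

represents-integer-form : Represents N M q k →
    (a q ≡ a k * M) × (b q ≡ b k * N)
  × (+ c q ≡ + (c k * N) - + (a k * M)) × (+ d q ≡ + (d k * M) - + (b k * N))
represents-integer-form r = a≡AM , b≡BN , m+n≡o⇒+m≡+o-+n c+AM≡CN , m+n≡o⇒+m≡+o-+n d+BN≡DM
  where open Represents r

lemma7p3 : (N M : ℕ) → 1 ≤ N → 1 ≤ M → (n : ℕ)
    → c (seq N M n) * d (seq N M n) ≡ 0
    → (∀ i → i < n → c (seq N M i) * d (seq N M i) ≢ 0)
    → Σ (ℕ → ℕ) λ A → Σ (ℕ → ℕ) λ B → Σ (ℕ → ℕ) λ C → Σ (ℕ → ℕ) λ D →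
        (∀ i → i ≤ n →
            (a (seq N M i) ≡ A i * M)
          × (b (seq N M i) ≡ B i * N)
          × (+ c (seq N M i) ≡ + (C i * N) - + (A i * M))
          × (+ d (seq N M i) ≡ + (D i * M) - + (B i * N)))
      × (∀ i → i < n → A i ≤ A (suc i) × B i ≤ B (suc i) × C i ≤ C (suc i) × D i ≤ D (suc i))
      × (A n ≤ N) × (D n ≤ N) × (B n ≤ M) × (C n ≤ M)
lemma7p3 N M 1≤N 1≤M n cd≡0 cd≢0 =
  a ∘ coeffs N M , b ∘ coeffs N M , c ∘ coeffs N M , d ∘ coeffs N M ,
  (λ i _ → represents-integer-form (seq-represents N M i)) ,
  (λ i _ → coeffStep-mono (seq N M i) (coeffs N M i)) ,
  coeffs-bounds 1≤N 1≤M n cd≡0 cd≢0
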